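{- Let $p,q$ be integers. The generating function $h^{(2)}(x)=\sum_{n=0}^{\infty}V_n^{(2)}x^n$ (as a formal power series) satisfies $$h^{(2)}(x)=\frac{4-2px-p^{2}x^{2}+2pqx^{3}}{1-px+pqx^{3}-q^{2}x^{4}}.$$
   Context: For integers $p,q$, let $\Delta=p^2-4q$, $\alpha=\frac{p+\sqrt{\Delta}}{2}$, $\beta=\frac{p-\sqrt{\Delta}}{2}$, and $V_n=\alpha^n+\beta^n$ (so $V_0=2$, $V_1=p$, $V_n=pV_{n-1}-qV_{n-2}$). For $n=2m+r$ with $m\geq0$, $r\in\{0,1\}$, define $V_n^{(2)}=(\alpha^{m+1}+\beta^{m+1})^{r}(\alpha^{m}+\beta^{m})^{2-r}$; equivalently $V_{2m}^{(2)}=V_m^2$ and $V_{2m+1}^{(2)}=V_mV_{m+1}$. -}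

module Defs where

open import Data.Nat as ℕ using (ℕ; zero; suc; _∸_)
open import Data.Nat.DivMod using (_/_; _%_)
open import Data.Integer using (ℤ; +_; -_; _+_; _-_; _*_; _^_)
open import Data.List using (List; []; _∷_; map; upTo; foldr)

V : ℤ → ℤ → ℕ → ℤ
V p q zero = + 2
V p q (suc zero) = p
V p q (suc (suc n)) = p * V p q (suc n) - q * V p q n

V2 : ℤ → ℤ → ℕ → ℤ
V2 p q n = (V p q (suc (n / 2)) ^ (n % 2)) * (V p q (n / 2) ^ (2 ∸ (n % 2)))

Series : Set
Series = ℕ → ℤ

_⋆_ : Series → Series → Series
(a ⋆ b) n = foldr _+_ (+ 0) (map (λ i → a i * b (n ∸ i)) (upTo (suc n)))

poly : List ℤ → Series
poly [] n = + 0
poly (c ∷ cs) zero = c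
poly (c ∷ cs) (suc n) = poly cs n

h2 : ℤ → ℤ → Series
h2 p q n = V2 p q n

numer : ℤ → ℤ → Series
numer p q = poly (+ 4 ∷ - (+ 2 * p) ∷ - (p * p) ∷ + 2 * p * q ∷ [])

denom : ℤ → ℤ → Series
denom p q = poly (+ 1 ∷ - p ∷ + 0 ∷ p * q ∷ - (q * q) ∷ [])

-- For n = 2m + r the coefficient V⁽²⁾ₙ is V_m² (r = 0) or V_{m+1} V_m (r = 1).
-- Substituting V_{m+2} = p V_{m+1} − q V_m into these products shows that both
-- parities satisfy
--   V⁽²⁾_{n+4} = p V⁽²⁾_{n+3} − pq V⁽²⁾_{n+1} + q² V⁽²⁾_n,
-- which says exactly that multiplication by 1 − px + pqx³ − q²x⁴ kills every
-- coefficient of degree ≥ 4; the first four coefficients are computed directly.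
module Submission where

open import Defs
open import Data.Nat using (ℕ; zero; suc; s≤s; z≤n)
import Data.Nat as ℕ
open import Data.Nat.DivMod using (_/_; _%_; m*n/n≡m; m*n%n≡0; [m+kn]%n≡m%n; m/n≡1+[m∸n]/n)
open import Data.Integer using (ℤ; +_; -_; _+_; _-_; _*_; _^_)
open import Data.Integer.Properties using (*-identityˡ; *-identityʳ)
open import Data.Integer.Tactic.RingSolver using (solve-∀; solve)
open import Data.List using ([]; _∷_; map; foldr; applyUpTo)
open import Data.List.Properties using (map-applyUpTo)
open import Relation.Binary.PropositionalEquality
  using (_≡_; refl; cong; cong₂; trans; module ≡-Reasoning)
open ≡-Reasoning

data EvenOrOdd : ℕ → Set where
  even : ∀ k → EvenOrOdd (k ℕ.* 2)
  odd  : ∀ k → EvenOrOdd (suc (k ℕ.* 2))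

evenOrOdd : ∀ n → EvenOrOdd n
evenOrOdd zero = even 0
evenOrOdd (suc n) with evenOrOdd n
... | even k = odd k
... | odd k  = even (suc k)

suc[k*2]/2≡k : ∀ k → suc (k ℕ.* 2) / 2 ≡ k
suc[k*2]/2≡k zero    = refl
suc[k*2]/2≡k (suc k) = trans (m/n≡1+[m∸n]/n {suc (suc k ℕ.* 2)} (s≤s (s≤s z≤n))) (cong suc (suc[k*2]/2≡k k))

DenomRecurrence : ℤ → ℤ → Series → Set
DenomRecurrence p q a = ∀ n → a (4 ℕ.+ n) ≡ p * a (3 ℕ.+ n) - p * q * a (1 ℕ.+ n) + q * q * a n

module _ (p q : ℤ) where

  V2-from-halves : ∀ n {m r} → n / 2 ≡ m → n % 2 ≡ r →
                   V2 p q n ≡ V p q (suc m) ^ r * V p q m ^ (2 ℕ.∸ r)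
  V2-from-halves n refl refl = refl

  V2-even : ∀ k → V2 p q (k ℕ.* 2) ≡ V p q k * V p q k
  V2-even k = begin
    V2 p q (k ℕ.* 2)                     ≡⟨ V2-from-halves (k ℕ.* 2) (m*n/n≡m k 2) (m*n%n≡0 k 2) ⟩
    + 1 * (V p q k * (V p q k * + 1))    ≡⟨ *-identityˡ _ ⟩
    V p q k * (V p q k * + 1)            ≡⟨ cong (V p q k *_) (*-identityʳ (V p q k)) ⟩
    V p q k * V p q k                    ∎

  V2-odd : ∀ k → V2 p q (suc (k ℕ.* 2)) ≡ V p q (suc k) * V p q k
  V2-odd k = trans (V2-from-halves (suc (k ℕ.* 2)) (suc[k*2]/2≡k k) ([m+kn]%n≡m%n 1 k 2))
                   (cong₂ _*_ (*-identityʳ (V p q (suc k))) (*-identityʳ (V p q k)))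

  V2-rec : DenomRecurrence p q (V2 p q)
  V2-rec n with evenOrOdd n
  ... | even k rewrite V2-even (suc (suc k)) | V2-odd (suc k) | V2-odd k | V2-even k =
    square-step p q (V p q (suc k)) (V p q k)
    where
    square-step : ∀ p q a b → (p * a - q * b) * (p * a - q * b)
                  ≡ p * ((p * a - q * b) * a) - p * q * (a * b) + q * q * (b * b)
    square-step = solve-∀
  ... | odd k rewrite V2-odd (suc (suc k)) | V2-even (suc (suc k)) | V2-even (suc k) | V2-odd k =
    product-step p q (V p q (suc k)) (V p q k)
    where
    product-step : ∀ p q a b → (p * (p * a - q * b) - q * a) * (p * a - q * b)
                   ≡ p * ((p * a - q * b) * (p * a - q * b)) - p * q * (a * a) + q * q * (a * b)
    product-step = solve-∀

sum-of-zeros : ∀ m → foldr _+_ (+ 0) (applyUpTo (λ _ → + 0) m) ≡ + 0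
sum-of-zeros zero    = refl
sum-of-zeros (suc m) = cong (_+_ (+ 0)) (sum-of-zeros m)

module _ (p q : ℤ) (a : Series) where

  -- The left-hand sides of the expand lemmas are the Cauchy sums as they compute.
  denom-⋆-1 : (denom p q ⋆ a) 1 ≡ a 1 - p * a 0
  denom-⋆-1 = expand p q (a 0) (a 1)
    where
    expand : ∀ p q a₀ a₁ → + 1 * a₁ + (- p * a₀ + + 0) ≡ a₁ - p * a₀
    expand = solve-∀

  denom-⋆-2 : (denom p q ⋆ a) 2 ≡ a 2 - p * a 1
  denom-⋆-2 = expand p q (a 0) (a 1) (a 2)
    where
    expand : ∀ p q a₀ a₁ a₂ → + 1 * a₂ + (- p * a₁ + (+ 0 * a₀ + + 0)) ≡ a₂ - p * a₁
    expand = solve-∀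

  denom-⋆-3 : (denom p q ⋆ a) 3 ≡ a 3 - p * a 2 + p * q * a 0
  denom-⋆-3 = expand p q (a 0) (a 1) (a 2) (a 3)
    where
    expand : ∀ p q a₀ a₁ a₂ a₃ → + 1 * a₃ + (- p * a₂ + (+ 0 * a₁ + (p * q * a₀ + + 0)))
             ≡ a₃ - p * a₂ + p * q * a₀
    expand = solve-∀

  denom-⋆-+4 : ∀ m → (denom p q ⋆ a) (4 ℕ.+ m)
               ≡ a (4 ℕ.+ m) - p * a (3 ℕ.+ m) + p * q * a (1 ℕ.+ m) - q * q * a m
  denom-⋆-+4 m = begin
    (denom p q ⋆ a) (4 ℕ.+ m)
      ≡⟨ cong leading (trans (cong (foldr _+_ (+ 0)) (map-applyUpTo (5 ℕ.+_) term m)) (sum-of-zeros m)) ⟩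
    leading (+ 0)
      ≡⟨ expand p q (a m) (a (1 ℕ.+ m)) (a (2 ℕ.+ m)) (a (3 ℕ.+ m)) (a (4 ℕ.+ m)) ⟩
    a (4 ℕ.+ m) - p * a (3 ℕ.+ m) + p * q * a (1 ℕ.+ m) - q * q * a m ∎
    where
    -- summands with index i ≥ 5 have the coefficient poly [] _ = + 0
    term : ℕ → ℤ
    term i = denom p q i * a (4 ℕ.+ m ℕ.∸ i)
    leading : ℤ → ℤ
    leading t = + 1 * a (4 ℕ.+ m) + (- p * a (3 ℕ.+ m) + (+ 0 * a (2 ℕ.+ m) + (p * q * a (1 ℕ.+ m) + (- (q * q) * a m + t))))
    expand : ∀ p q a₀ a₁ a₂ a₃ a₄ → + 1 * a₄ + (- p * a₃ + (+ 0 * a₂ + (p * q * a₁ + (- (q * q) * a₀ + + 0))))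
             ≡ a₄ - p * a₃ + p * q * a₁ - q * q * a₀
    expand = solve-∀

  denom-⋆-vanishes : DenomRecurrence p q a → ∀ m → (denom p q ⋆ a) (4 ℕ.+ m) ≡ + 0
  denom-⋆-vanishes rec m = trans (denom-⋆-+4 m) (cancel (rec m))
    where
    cancel : ∀ {a₀ a₁ a₃ a₄} → a₄ ≡ p * a₃ - p * q * a₁ + q * q * a₀ →
             a₄ - p * a₃ + p * q * a₁ - q * q * a₀ ≡ + 0
    cancel {a₀} {a₁} {a₃} refl = identity p q a₀ a₁ a₃
      where
      identity : ∀ p q a₀ a₁ a₃ → p * a₃ - p * q * a₁ + q * q * a₀ - p * a₃ + p * q * a₁ - q * q * a₀ ≡ + 0
      identity = solve-∀

theorem6 : (p q : ℤ) → (n : ℕ) → (denom p q ⋆ h2 p q) n ≡ numer p q n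
theorem6 p q 0 = refl
theorem6 p q 1 = begin
  (denom p q ⋆ h2 p q) 1          ≡⟨ denom-⋆-1 p q (h2 p q) ⟩
  h2 p q 1 - p * + 4              ≡⟨ cong (_- p * + 4) (V2-odd p q 0) ⟩
  p * + 2 - p * + 4               ≡⟨ solve (p ∷ []) ⟩
  - (+ 2 * p)                     ∎
theorem6 p q 2 = begin
  (denom p q ⋆ h2 p q) 2          ≡⟨ denom-⋆-2 p q (h2 p q) ⟩
  h2 p q 2 - p * h2 p q 1         ≡⟨ cong₂ (λ x y → x - p * y) (V2-even p q 1) (V2-odd p q 0) ⟩
  p * p - p * (p * + 2)           ≡⟨ solve (p ∷ []) ⟩
  - (p * p)                       ∎
theorem6 p q 3 = begin
  (denom p q ⋆ h2 p q) 3          ≡⟨ denom-⋆-3 p q (h2 p q) ⟩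
  h2 p q 3 - p * h2 p q 2 + p * q * + 4
    ≡⟨ cong₂ (λ x y → x - p * y + p * q * + 4) (V2-odd p q 1) (V2-even p q 1) ⟩
  (p * p - q * + 2) * p - p * (p * p) + p * q * + 4 ≡⟨ solve (p ∷ q ∷ []) ⟩
  + 2 * p * q                     ∎
theorem6 p q (suc (suc (suc (suc m)))) = denom-⋆-vanishes p q (h2 p q) (V2-rec p q) m
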